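{- Let $G=(V,E)$ be an undirected graph (possibly with self-loops, without parallel edges), let $\mathcal{T}$ be a set of triangles of $G$, let $M$ be a $2$-matching of $G$, and let $T$ be a triangle of $G$ (not necessarily in $\mathcal{T}$). If $|M\cap T|=2$, then $M$ is $\mathcal{T}(T)$-free.
   Context: For $u\in V$ and $F\subseteq E$, $d_F(u)$ is the number of edges of $F$ incident to $u$, where a self-loop is counted twice. A $2$-matching is an edge set $M\subseteq E$ with $d_M(v)\leq 2$ for all $v\in V$. A triangle is an edge set forming a cycle with $3$ edges. For a set $\mathcal{S}$ of triangles, an edge set is $\mathcal{S}$-free if it contains no triangle of $\mathcal{S}$ as a subset. For $F\subseteq E$, $\mathcal{T}(F)$ denotes the set of triangles in $\mathcal{T}$ that contain at least one edge of $F$. -}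

module Defs where

open import Data.Nat using (ℕ; _+_; _≤_; _≤ᵇ_)
open import Data.Nat.ListAction using (sum)
open import Data.Bool using (Bool; true; false; _∧_; if_then_else_)
open import Data.Fin using (Fin; toℕ)
open import Data.List using (List; map; allFin)
open import Data.Product using (Σ; _×_; ∃-syntax)
open import Data.Sum using (_⊎_)
open import Relation.Binary.PropositionalEquality using (_≡_; _≢_)
open import Relation.Nullary using (¬_)
open import Function.Bundles using (_⇔_)

-- An edge set on vertex set Fin n: the edge {u,v} (u = v allowed: self-loop)
-- belongs to F iff F u v ≡ true.
-- Since edges are unordered pairs, there are no parallel edges.
EdgeSet : ℕ → Set
EdgeSet n = Fin n → Fin n → Bool

Symmetric : ∀ {n} → EdgeSet n → Set
Symmetric F = ∀ u v → F u v ≡ F v u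

_⊆ₑ_ : ∀ {n} → EdgeSet n → EdgeSet n → Set
F ⊆ₑ H = ∀ u v → F u v ≡ true → H u v ≡ true

_∩ₑ_ : ∀ {n} → EdgeSet n → EdgeSet n → EdgeSet n
(F ∩ₑ H) u v = F u v ∧ H u v

record Graph : Set where
  field
    n   : ℕ
    E   : EdgeSet n
    sym : Symmetric E
open Graph public

count : ∀ {n} → (Fin n → Bool) → ℕ
count {n} f = sum (map (λ i → if f i then 1 else 0) (allFin n))

-- d_F(u): edges of F incident to u, a self-loop counted twice
degree : ∀ {n} → EdgeSet n → Fin n → ℕ
degree F u = count (F u) + (if F u u then 1 else 0)

-- |F|: number of (unordered) edges in F, each {u,v} counted once via u ≤ v
size : ∀ {n} → EdgeSet n → ℕ
size {n} F = sum (map (λ u → count (λ v → F u v ∧ (toℕ u ≤ᵇ toℕ v))) (allFin n))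

IsEdgeSubset : (G : Graph) → EdgeSet (n G) → Set
IsEdgeSubset G F = Symmetric F × (F ⊆ₑ E G)

Is2Matching : (G : Graph) → EdgeSet (n G) → Set
Is2Matching G M = IsEdgeSubset G M × (∀ v → degree M v ≤ 2)

Adj3 : ∀ {n} → (a b c x y : Fin n) → Set
Adj3 a b c x y =
  ((x ≡ a × y ≡ b) ⊎ (x ≡ b × y ≡ a)) ⊎
  (((x ≡ b × y ≡ c) ⊎ (x ≡ c × y ≡ b)) ⊎
   ((x ≡ a × y ≡ c) ⊎ (x ≡ c × y ≡ a)))

IsTriangle : (G : Graph) → EdgeSet (n G) → Set
IsTriangle G T =
  (T ⊆ₑ E G) ×
  (∃[ a ] ∃[ b ] ∃[ c ] (a ≢ b × b ≢ c × a ≢ c ×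
     (∀ x y → (T x y ≡ true) ⇔ Adj3 a b c x y)))

EdgeSetFamily : ℕ → Set₁
EdgeSetFamily n = EdgeSet n → Set

TrianglesMeeting : ∀ {n} → EdgeSetFamily n → EdgeSet n → EdgeSetFamily n
TrianglesMeeting 𝒯 F T' = 𝒯 T' × (∃[ u ] ∃[ v ] (F u v ≡ true × T' u v ≡ true))

IsFree : ∀ {n} → EdgeSetFamily n → EdgeSet n → Set
IsFree 𝒮 F = ∀ T' → 𝒮 T' → ¬ (T' ⊆ₑ F)

-- Let T' ∈ 𝒯 share the edge uv with T and suppose T' ⊆ M; write T = {uv, vz, uz}
-- and T' = {uv, vw, uw}. If z = w then T ⊆ M and |M ∩ T| = 3. Otherwise u and v
-- already have the two M-neighbours {v, w} resp. {u, w}, so the degree bound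
-- keeps uz and vz out of M and |M ∩ T| = 1.
module Submission where

open import Defs
open import Data.Nat using (ℕ)
open import Relation.Binary.PropositionalEquality using (_≡_)

open import Data.Nat using (zero; suc; _+_; _≤_; z≤n)
import Data.Nat.Properties as ℕ
open import Data.Nat.ListAction using (sum)
open import Data.Bool using (Bool; true; false; _∧_; _∨_; if_then_else_)
open import Data.Bool.Properties using (∧-conicalˡ; ∧-conicalʳ)
open import Data.Fin as Fin using (Fin; toℕ)
open import Data.Fin.Properties as Finₚ using (_≟_; suc-injective)
open import Data.List using (tabulate)
open import Data.List.Properties using (map-tabulate)
open import Data.Product using (_×_; _,_; proj₁; proj₂; ∃-syntax)
open import Data.Sum using (_⊎_; inj₁; inj₂; [_,_]′; swap)
open import Data.Empty using (⊥)
open import Function using (_∘_; id)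
open import Function.Bundles using (_⇔_; mk⇔; Equivalence)
import Function.Properties.Equivalence as ⇔
open import Relation.Binary.PropositionalEquality as ≡
  using (_≢_; refl; trans; cong; cong₂; subst₂)
open import Relation.Nullary using (Dec; yes; no; does; _×-dec_; _⊎-dec_; contradiction)
open import Relation.Nullary.Decidable using (dec-true; dec-false)
open import Algebra.Properties.CommutativeMonoid.Sum ℕ.+-0-commutativeMonoid
  using (sum-syntax; sum-cong-≗; ∑-distrib-+; sum-replicate-zero) renaming (sum to ∑)

open Equivalence using (to; from)

indicator : Bool → ℕ
indicator b = if b then 1 else 0

∑-mono-≤ : ∀ {k} {f g : Fin k → ℕ} → (∀ i → f i ≤ g i) → ∑ f ≤ ∑ g
∑-mono-≤ {zero}  f≤g = z≤n
∑-mono-≤ {suc k} f≤g = ℕ.+-mono-≤ (f≤g Fin.zero) (∑-mono-≤ (f≤g ∘ Fin.suc))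

∑-zero : ∀ {k} {f : Fin k → ℕ} → (∀ i → f i ≡ 0) → ∑ f ≡ 0
∑-zero {k} f≗0 = trans (sum-cong-≗ f≗0) (sum-replicate-zero k)

∑-single : ∀ {k} (f : Fin k → ℕ) (x : Fin k) → (∀ i → i ≢ x → f i ≡ 0) → ∑ f ≡ f x
∑-single f Fin.zero f≗0 =
  trans (cong (f Fin.zero +_) (∑-zero (λ i → f≗0 (Fin.suc i) λ ()))) (ℕ.+-identityʳ _)
∑-single f (Fin.suc x) f≗0 = trans (cong (_+ ∑ (f ∘ Fin.suc)) (f≗0 Fin.zero λ ()))
  (∑-single (f ∘ Fin.suc) x λ i i≢x → f≗0 (Fin.suc i) (i≢x ∘ suc-injective))

∑-indicator-≟ : ∀ {k} (x : Fin k) → ∑[ i < k ] indicator (does (i ≟ x)) ≡ 1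
∑-indicator-≟ x = trans (∑-single _ x λ i i≢x → cong indicator (dec-false (i ≟ x) i≢x))
                        (cong indicator (dec-true (x ≟ x) refl))

sum-tabulate : ∀ {k} (f : Fin k → ℕ) → sum (tabulate f) ≡ ∑ f
sum-tabulate {zero}  f = refl
sum-tabulate {suc k} f = cong (f Fin.zero +_) (sum-tabulate (f ∘ Fin.suc))

count≡∑ : ∀ {k} (f : Fin k → Bool) → count f ≡ ∑[ i < k ] indicator (f i)
count≡∑ f = trans (cong sum (map-tabulate id (indicator ∘ f))) (sum-tabulate (indicator ∘ f))

3≤count : ∀ {k} (f : Fin k → Bool) {x y z : Fin k} → x ≢ y → y ≢ z → x ≢ z →
          f x ≡ true → f y ≡ true → f z ≡ true → 3 ≤ count f
3≤count {k} f {x} {y} {z} x≢y y≢z x≢z fx fy fz =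
  subst₂ _≤_ ∑three≡3 (≡.sym (count≡∑ f)) (∑-mono-≤ three≤f)
  where
  δ : Fin k → Fin k → ℕ
  δ a i = indicator (does (i ≟ a))

  ∑three≡3 : ∑[ i < k ] (δ x i + δ y i + δ z i) ≡ 3
  ∑three≡3 = trans (∑-distrib-+ (λ i → δ x i + δ y i) (δ z))
    (cong₂ _+_ (trans (∑-distrib-+ (δ x) (δ y)) (cong₂ _+_ (∑-indicator-≟ x) (∑-indicator-≟ y)))
               (∑-indicator-≟ z))

  three≤f : ∀ i → δ x i + δ y i + δ z i ≤ indicator (f i)
  three≤f i with i ≟ x | i ≟ y | i ≟ z
  ... | yes refl | yes i≡y  | _        = contradiction i≡y x≢y
  ... | yes refl | no _     | yes i≡z  = contradiction i≡z x≢z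
  ... | yes refl | no _     | no _     rewrite fx = ℕ.≤-refl
  ... | no _     | yes refl | yes i≡z  = contradiction i≡z y≢z
  ... | no _     | yes refl | no _     rewrite fy = ℕ.≤-refl
  ... | no _     | no _     | yes refl rewrite fz = ℕ.≤-refl
  ... | no _     | no _     | no _     = z≤n

3≤degree : ∀ {k} (M : EdgeSet k) {u x y z : Fin k} → x ≢ y → y ≢ z → x ≢ z →
           M u x ≡ true → M u y ≡ true → M u z ≡ true → 3 ≤ degree M u
3≤degree M x≢y y≢z x≢z ux uy uz =
  ℕ.≤-trans (3≤count (M _) x≢y y≢z x≢z ux uy uz) (ℕ.m≤m+n _ _)

≡true⇔⇒≡ : ∀ {a b} → (a ≡ true ⇔ b ≡ true) → a ≡ b
≡true⇔⇒≡ {true}  a⇔b = ≡.sym (to a⇔b refl)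
≡true⇔⇒≡ {false} {true}  a⇔b with () ← from a⇔b refl
≡true⇔⇒≡ {false} {false} a⇔b = refl

does≡true⇔ : ∀ {A : Set} (a? : Dec A) → (does a? ≡ true) ⇔ A
does≡true⇔ a? = mk⇔ (witness a?) (dec-true a?)
  where
  witness : ∀ {A : Set} (a? : Dec A) → does a? ≡ true → A
  witness (yes a) _ = a

-- Definitionally toℕ u ≤ᵇ toℕ v, the orientation test in size.
_≤ᶠ_ : ∀ {k} → Fin k → Fin k → Bool
u ≤ᶠ v = does (toℕ u ℕ.≤? toℕ v)

size≡∑∑ : ∀ {k} (F : EdgeSet k) → size F ≡ ∑[ u < k ] ∑[ v < k ] indicator (F u v ∧ u ≤ᶠ v)
size≡∑∑ {k} F = trans (cong sum (map-tabulate id row))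
  (trans (sum-tabulate row) (sum-cong-≗ λ u → count≡∑ (F↑ u)))
  where
  F↑ : Fin k → Fin k → Bool
  F↑ u v = F u v ∧ u ≤ᶠ v
  row : Fin k → ℕ
  row u = count (F↑ u)

size-cong : ∀ {k} {F H : EdgeSet k} → (∀ u v → F u v ≡ H u v) → size F ≡ size H
size-cong {F = F} {H} F≗H = trans (size≡∑∑ F) (trans
  (sum-cong-≗ λ u → sum-cong-≗ λ v → cong (λ b → indicator (b ∧ u ≤ᶠ v)) (F≗H u v))
  (≡.sym (size≡∑∑ H)))

size-cong-⇔ : ∀ {k} {F H : EdgeSet k} → (∀ u v → F u v ≡ true ⇔ H u v ≡ true) → size F ≡ size H
size-cong-⇔ F⇔H = size-cong λ u v → ≡true⇔⇒≡ (F⇔H u v)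

_∪ₑ_ : ∀ {k} → EdgeSet k → EdgeSet k → EdgeSet k
(F ∪ₑ H) u v = F u v ∨ H u v

Disjointₑ : ∀ {k} → EdgeSet k → EdgeSet k → Set
Disjointₑ F H = ∀ u v → F u v ≡ true → H u v ≡ true → ⊥

size-∪ : ∀ {k} {F H : EdgeSet k} → Disjointₑ F H → size (F ∪ₑ H) ≡ size F + size H
size-∪ {k} {F} {H} F∩H=∅ = trans (size≡∑∑ (F ∪ₑ H)) (trans
  (sum-cong-≗ λ u → trans (sum-cong-≗ λ v → indicator-∨ (F∩H=∅ u v)) (∑-distrib-+ (F↑ u) (H↑ u)))
  (trans (∑-distrib-+ (∑ ∘ F↑) (∑ ∘ H↑)) (≡.sym (cong₂ _+_ (size≡∑∑ F) (size≡∑∑ H)))))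
  where
  F↑ H↑ : Fin k → Fin k → ℕ
  F↑ u v = indicator (F u v ∧ u ≤ᶠ v)
  H↑ u v = indicator (H u v ∧ u ≤ᶠ v)
  indicator-∨ : ∀ {a b c} → (a ≡ true → b ≡ true → ⊥) →
                indicator ((a ∨ b) ∧ c) ≡ indicator (a ∧ c) + indicator (b ∧ c)
  indicator-∨ {true}  {true}          a∩b=∅ = contradiction refl (a∩b=∅ refl)
  indicator-∨ {true}  {false} {true}  _ = refl
  indicator-∨ {true}  {false} {false} _ = refl
  indicator-∨ {false}         {true}  _ = refl
  indicator-∨ {false}         {false} _ = refl

arc : ∀ {k} → Fin k → Fin k → EdgeSet k
arc x y p q = does (p ≟ x ×-dec q ≟ y)

arc≡true⇔ : ∀ {k} (x y p q : Fin k) → arc x y p q ≡ true ⇔ (p ≡ x × q ≡ y)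
arc≡true⇔ x y p q = does≡true⇔ (p ≟ x ×-dec q ≟ y)

size-arc : ∀ {k} (x y : Fin k) → size (arc x y) ≡ indicator (x ≤ᶠ y)
size-arc {k} x y = begin
  size (arc x y)                 ≡⟨ size≡∑∑ (arc x y) ⟩
  ∑[ u < k ] ∑[ v < k ] a↑ u v   ≡⟨ ∑-single (∑ ∘ a↑) x (λ u u≢x → ∑-zero (off-row u≢x)) ⟩
  ∑[ v < k ] a↑ x v              ≡⟨ ∑-single (a↑ x) y off-column ⟩
  a↑ x y                         ≡⟨ cong (λ b → indicator (b ∧ x ≤ᶠ y)) on-diagonal ⟩
  indicator (x ≤ᶠ y)             ∎
  where
  open ≡.≡-Reasoning
  a↑ : Fin k → Fin k → ℕ
  a↑ u v = indicator (arc x y u v ∧ u ≤ᶠ v)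
  off-row : ∀ {u} → u ≢ x → ∀ v → a↑ u v ≡ 0
  off-row {u} u≢x v = cong (λ b → indicator ((b ∧ does (v ≟ y)) ∧ u ≤ᶠ v)) (dec-false (u ≟ x) u≢x)
  off-column : ∀ v → v ≢ y → a↑ x v ≡ 0
  off-column v v≢y =
    cong (λ b → indicator (b ∧ x ≤ᶠ v)) (dec-false (x ≟ x ×-dec v ≟ y) (v≢y ∘ proj₂))
  on-diagonal : arc x y x y ≡ true
  on-diagonal = dec-true (x ≟ x ×-dec y ≟ y) (refl , refl)

indicator-≤ᶠ-antisym : ∀ {k} {x y : Fin k} → x ≢ y → indicator (x ≤ᶠ y) + indicator (y ≤ᶠ x) ≡ 1
indicator-≤ᶠ-antisym {x = x} {y} x≢y with ℕ.≤-total (toℕ x) (toℕ y)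
... | inj₁ x≤y = cong₂ (λ a b → indicator a + indicator b)
  (dec-true (toℕ x ℕ.≤? toℕ y) x≤y) (dec-false (toℕ y ℕ.≤? toℕ x) (x≢y ∘ Finₚ.≤-antisym x≤y))
... | inj₂ y≤x = cong₂ (λ a b → indicator a + indicator b)
  (dec-false (toℕ x ℕ.≤? toℕ y) (x≢y ∘ ≡.sym ∘ Finₚ.≤-antisym y≤x))
  (dec-true (toℕ y ℕ.≤? toℕ x) y≤x)

edge : ∀ {k} → Fin k → Fin k → EdgeSet k
edge x y = arc x y ∪ₑ arc y x

edge≡true⇔ : ∀ {k} (x y p q : Fin k) → edge x y p q ≡ true ⇔ ((p ≡ x × q ≡ y) ⊎ (p ≡ y × q ≡ x))
edge≡true⇔ x y p q = does≡true⇔ ((p ≟ x ×-dec q ≟ y) ⊎-dec (p ≟ y ×-dec q ≟ x))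

size-edge : ∀ {k} {x y : Fin k} → x ≢ y → size (edge x y) ≡ 1
size-edge {x = x} {y} x≢y = trans (size-∪ arcs-disjoint)
  (trans (cong₂ _+_ (size-arc x y) (size-arc y x)) (indicator-≤ᶠ-antisym x≢y))
  where
  arcs-disjoint : Disjointₑ (arc x y) (arc y x)
  arcs-disjoint p q xy yx with to (arc≡true⇔ x y p q) xy | to (arc≡true⇔ y x p q) yx
  ... | refl , refl | p≡y , _ = x≢y p≡y

edge-shared : ∀ {k} (x y x′ y′ p q : Fin k) → edge x y p q ≡ true → edge x′ y′ p q ≡ true →
              (x ≡ x′ × y ≡ y′) ⊎ (x ≡ y′ × y ≡ x′)
edge-shared x y x′ y′ p q e e′ with to (edge≡true⇔ x y p q) e | to (edge≡true⇔ x′ y′ p q) e′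
... | inj₁ (refl , refl) | inj₁ (refl , refl) = inj₁ (refl , refl)
... | inj₁ (refl , refl) | inj₂ (refl , refl) = inj₂ (refl , refl)
... | inj₂ (refl , refl) | inj₁ (refl , refl) = inj₂ (refl , refl)
... | inj₂ (refl , refl) | inj₂ (refl , refl) = inj₁ (refl , refl)

triangle : ∀ {k} → Fin k → Fin k → Fin k → EdgeSet k
triangle a b c = edge a b ∪ₑ (edge b c ∪ₑ edge a c)

triangle≡true⇔ : ∀ {k} (a b c p q : Fin k) → triangle a b c p q ≡ true ⇔ Adj3 a b c p q
triangle≡true⇔ a b c p q = does≡true⇔ (edge? a b ⊎-dec (edge? b c ⊎-dec edge? a c))
  where
  edge? : ∀ x y → Dec ((p ≡ x × q ≡ y) ⊎ (p ≡ y × q ≡ x))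
  edge? x y = (p ≟ x ×-dec q ≟ y) ⊎-dec (p ≟ y ×-dec q ≟ x)

size-triangle : ∀ {k} {a b c : Fin k} → a ≢ b → b ≢ c → a ≢ c → size (triangle a b c) ≡ 3
size-triangle {a = a} {b} {c} a≢b b≢c a≢c =
  trans (size-∪ ab∩bc∪ac=∅) (cong₂ _+_ (size-edge a≢b)
    (trans (size-∪ bc∩ac=∅) (cong₂ _+_ (size-edge b≢c) (size-edge a≢c))))
  where
  bc∩ac=∅ : Disjointₑ (edge b c) (edge a c)
  bc∩ac=∅ p q bc ac = [ a≢b ∘ ≡.sym ∘ proj₁ , b≢c ∘ proj₁ ]′ (edge-shared b c a c p q bc ac)
  ab∩bc∪ac=∅ : Disjointₑ (edge a b) (edge b c ∪ₑ edge a c)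
  ab∩bc∪ac=∅ p q ab bc∪ac with edge b c p q in bc
  ... | true  = [ a≢b ∘ proj₁ , a≢c ∘ proj₁ ]′ (edge-shared a b b c p q ab bc)
  ... | false = [ b≢c ∘ proj₂ , a≢c ∘ proj₁ ]′ (edge-shared a b a c p q ab bc∪ac)

-- IsTriangle G T unfolds to T ⊆ₑ E G × ∃ a b c. IsTriangleOn T a b c.
IsTriangleOn : ∀ {k} → EdgeSet k → Fin k → Fin k → Fin k → Set
IsTriangleOn T a b c = a ≢ b × b ≢ c × a ≢ c × (∀ x y → (T x y ≡ true) ⇔ Adj3 a b c x y)

Adj3-swap : ∀ {k} {a b c p q : Fin k} → Adj3 a b c p q ⇔ Adj3 b a c p q
Adj3-swap = mk⇔ exchange exchange
  where
  exchange : ∀ {k} {a b c p q : Fin k} → Adj3 a b c p q → Adj3 b a c p q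
  exchange (inj₁ ab)        = inj₁ (swap ab)
  exchange (inj₂ (inj₁ bc)) = inj₂ (inj₂ bc)
  exchange (inj₂ (inj₂ ac)) = inj₂ (inj₁ ac)

Adj3-rotate : ∀ {k} {a b c p q : Fin k} → Adj3 a b c p q ⇔ Adj3 b c a p q
Adj3-rotate = mk⇔ rotate (rotate ∘ rotate)
  where
  rotate : ∀ {k} {a b c p q : Fin k} → Adj3 a b c p q → Adj3 b c a p q
  rotate (inj₁ ab)        = inj₂ (inj₂ (swap ab))
  rotate (inj₂ (inj₁ bc)) = inj₁ bc
  rotate (inj₂ (inj₂ ac)) = inj₂ (inj₁ (swap ac))

reroot : ∀ {k} {T : EdgeSet k} {a b c u v : Fin k} →
         IsTriangleOn T a b c → T u v ≡ true → ∃[ z ] IsTriangleOn T u v z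
reroot {T = T} {a} {b} {c} (a≢b , b≢c , a≢c , T⇔abc) Tuv = go (to (T⇔abc _ _) Tuv)
  where
  relabel : ∀ {x y z} → x ≢ y → y ≢ z → x ≢ z → (∀ {p q} → Adj3 a b c p q ⇔ Adj3 x y z p q) →
            IsTriangleOn T x y z
  relabel x≢y y≢z x≢z abc⇔xyz = x≢y , y≢z , x≢z , λ p q → ⇔.trans (T⇔abc p q) abc⇔xyz
  go : ∀ {u v} → Adj3 a b c u v → ∃[ z ] IsTriangleOn T u v z
  go (inj₁ (inj₁ (refl , refl)))        = c , relabel a≢b b≢c a≢c ⇔.refl
  go (inj₁ (inj₂ (refl , refl)))        = c , relabel (a≢b ∘ ≡.sym) a≢c b≢c Adj3-swap
  go (inj₂ (inj₁ (inj₁ (refl , refl)))) = a , relabel b≢c (a≢c ∘ ≡.sym) (a≢b ∘ ≡.sym) Adj3-rotate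
  go (inj₂ (inj₁ (inj₂ (refl , refl)))) = a , relabel (b≢c ∘ ≡.sym) (a≢b ∘ ≡.sym) (a≢c ∘ ≡.sym)
                                                (⇔.trans Adj3-rotate Adj3-swap)
  go (inj₂ (inj₂ (inj₁ (refl , refl)))) = b , relabel a≢c (b≢c ∘ ≡.sym) a≢b
                                                (⇔.trans Adj3-swap Adj3-rotate)
  go (inj₂ (inj₂ (inj₂ (refl , refl)))) = b , relabel (a≢c ∘ ≡.sym) a≢b (b≢c ∘ ≡.sym)
                                                (⇔.trans Adj3-rotate Adj3-rotate)

∩ₑ≡true⇔ : ∀ {k} (F H : EdgeSet k) (p q : Fin k) →
           (F ∩ₑ H) p q ≡ true ⇔ (F p q ≡ true × H p q ≡ true)
∩ₑ≡true⇔ F H p q =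
  mk⇔ (λ FH → ∧-conicalˡ _ _ FH , ∧-conicalʳ (F p q) _ FH) (λ (Fpq , Hpq) → cong₂ _∧_ Fpq Hpq)

size-∩-⊇ : ∀ {k} {M T : EdgeSet k} → T ⊆ₑ M → size (M ∩ₑ T) ≡ size T
size-∩-⊇ {M = M} {T} T⊆M = size-cong-⇔ λ p q →
  mk⇔ (proj₂ ∘ to (∩ₑ≡true⇔ M T p q)) (λ Tpq → from (∩ₑ≡true⇔ M T p q) (T⊆M p q Tpq , Tpq))

size-IsTriangleOn : ∀ {k} {T : EdgeSet k} {a b c : Fin k} → IsTriangleOn T a b c → size T ≡ 3
size-IsTriangleOn {a = a} {b} {c} (a≢b , b≢c , a≢c , T⇔) =
  trans (size-cong-⇔ λ p q → ⇔.trans (T⇔ p q) (⇔.sym (triangle≡true⇔ a b c p q)))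
        (size-triangle a≢b b≢c a≢c)

size-∩≡1 : (G : Graph) {M T : EdgeSet (n G)} {u v z w : Fin (n G)} →
           Is2Matching G M → IsTriangleOn T u v z → u ≢ w → v ≢ w → z ≢ w →
           M u v ≡ true → M v w ≡ true → M u w ≡ true → size (M ∩ₑ T) ≡ 1
size-∩≡1 G {M} {T} {u} {v} {z} {w}
         ((M-sym , _) , deg≤2) (u≢v , v≢z , u≢z , T⇔) u≢w v≢w z≢w uv vw uw =
  trans (size-cong-⇔ M∩T⇔uv) (size-edge u≢v)
  where
  vz∉M : M v z ≢ true
  vz∉M vz = ℕ.≤⇒≯ (deg≤2 v) (3≤degree M u≢w (z≢w ∘ ≡.sym) u≢z (trans (M-sym v u) uv) vw vz)
  uz∉M : M u z ≢ true
  uz∉M uz = ℕ.≤⇒≯ (deg≤2 u) (3≤degree M v≢w (z≢w ∘ ≡.sym) v≢z uv uw uz)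
  only-uv : ∀ {p q} → M p q ≡ true → Adj3 u v z p q → (p ≡ u × q ≡ v) ⊎ (p ≡ v × q ≡ u)
  only-uv _  (inj₁ uv∨vu)                       = uv∨vu
  only-uv vz (inj₂ (inj₁ (inj₁ (refl , refl)))) = contradiction vz vz∉M
  only-uv zv (inj₂ (inj₁ (inj₂ (refl , refl)))) = contradiction (trans (M-sym v z) zv) vz∉M
  only-uv uz (inj₂ (inj₂ (inj₁ (refl , refl)))) = contradiction uz uz∉M
  only-uv zu (inj₂ (inj₂ (inj₂ (refl , refl)))) = contradiction (trans (M-sym u z) zu) uz∉M
  uv∈M∩T : ∀ {p q} → (p ≡ u × q ≡ v) ⊎ (p ≡ v × q ≡ u) → M p q ≡ true × Adj3 u v z p q
  uv∈M∩T (inj₁ (refl , refl)) = uv , inj₁ (inj₁ (refl , refl))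
  uv∈M∩T (inj₂ (refl , refl)) = trans (M-sym v u) uv , inj₁ (inj₂ (refl , refl))
  M∩T⇔uv : ∀ p q → (M ∩ₑ T) p q ≡ true ⇔ edge u v p q ≡ true
  M∩T⇔uv p q = mk⇔
    (λ MT → let (Mpq , Tpq) = to (∩ₑ≡true⇔ M T p q) MT
            in from (edge≡true⇔ u v p q) (only-uv Mpq (to (T⇔ p q) Tpq)))
    (λ e → let (Mpq , adj) = uv∈M∩T (to (edge≡true⇔ u v p q) e)
           in from (∩ₑ≡true⇔ M T p q) (Mpq , from (T⇔ p q) adj))

size-∩-triangle≢2 : (G : Graph) {M T T′ : EdgeSet (n G)} {u v z w : Fin (n G)} →
                    Is2Matching G M → IsTriangleOn T u v z → IsTriangleOn T′ u v w → T′ ⊆ₑ M →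
                    size (M ∩ₑ T) ≢ 2
size-∩-triangle≢2 G {M} {T} {T′} {u} {v} {z} {w}
                  M-2matching T-on@(_ , _ , _ , T⇔) (_ , v≢w , u≢w , T′⇔) T′⊆M |M∩T|≡2 with z ≟ w
... | yes refl =
  contradiction (trans (≡.sym |M∩T|≡2) (trans (size-∩-⊇ T⊆M) (size-IsTriangleOn T-on))) λ ()
  where
  T⊆M : T ⊆ₑ M
  T⊆M p q Tpq = T′⊆M p q (from (T′⇔ p q) (to (T⇔ p q) Tpq))
... | no z≢w =
  contradiction (trans (≡.sym |M∩T|≡2) (size-∩≡1 G M-2matching T-on u≢w v≢w z≢w uv vw uw)) λ ()
  where
  T′∋ : ∀ {p q} → Adj3 u v w p q → M p q ≡ true
  T′∋ {p} {q} adj = T′⊆M p q (from (T′⇔ p q) adj)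
  uv : M u v ≡ true
  uv = T′∋ (inj₁ (inj₁ (refl , refl)))
  vw : M v w ≡ true
  vw = T′∋ (inj₂ (inj₁ (inj₁ (refl , refl))))
  uw : M u w ≡ true
  uw = T′∋ (inj₂ (inj₂ (inj₁ (refl , refl))))

mainTheorem5 : (G : Graph) (𝒯 : EdgeSetFamily (n G)) →
               (∀ T' → 𝒯 T' → IsTriangle G T') →
               (M : EdgeSet (n G)) → Is2Matching G M →
               (T : EdgeSet (n G)) → IsTriangle G T →
               size (M ∩ₑ T) ≡ 2 →
               IsFree (TrianglesMeeting 𝒯 T) M
mainTheorem5 G 𝒯 𝒯-triangles M M-2matching T (_ , _ , _ , _ , T-on) |M∩T|≡2
             T′ (T′∈𝒯 , u , v , Tuv , T′uv) T′⊆M =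
  let (_ , _ , _ , _ , T′-on) = 𝒯-triangles T′ T′∈𝒯
      (_ , T-on-uv)  = reroot T-on Tuv
      (_ , T′-on-uv) = reroot T′-on T′uv
  in size-∩-triangle≢2 G M-2matching T-on-uv T′-on-uv T′⊆M |M∩T|≡2
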